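{- Let $D$ be a finite set with $|D|\ge2$ and let $\mathcal{H}$ be a finite weighted constraint language over $D$ taking values in $\mathbb{Q}_{\geq0}$. Let $\mathcal{B}_1(D,\mathbb{Q}_{\ge0})$ be the set of all functions $D\to\mathbb{Q}_{\ge0}$ and $\mathcal{B}_1'$ the set of all functions $D\to\{1,2\}$. The following are equivalent: (1) $\mathcal{H}\cup\mathcal{B}_1'$ is balanced; (2) every finite subset of $\mathcal{H}\cup\mathcal{B}_1(D,\mathbb{Q}_{\ge0})$ is balanced; (3) $\mathcal{H}\cup\mathcal{B}_1(D,\mathbb{Q}_{\ge0})$ is balanced.
   Context: A weighted constraint language is a set of functions $D^k\to\mathbb{Q}_{\ge0}$ (various $k$). $\mathrm{EQ}(x,y)=1$ if $x=y$, else $0$. A pps-formula over $\mathcal{F}$ is $\sum_{v_{n+1},\dots,v_{n+k}}\prod_j\phi_j$ where each $\phi_j$ applies a function of $\mathcal{F}$ to a tuple of variables (repetitions allowed); it represents the function of the free variables $v_1,\dots,v_n$ obtained by summing the product over all assignments in $D^k$ to the bound variables. $\langle\mathcal{F}\rangle_\#$ is the set of functions represented by pps-formulas over $\mathcal{F}\cup\{\mathrm{EQ}\}$. For a matrix $\mathbf{M}$, let $G_{\mathbf{M}}$ be the bipartite graph on rows and columns with an edge $(r,c)$ iff $\mathbf{M}_{rc}\ne0$; a block is the submatrix on the rows and columns of a connected component; $\mathbf{M}$ has block-rank $1$ if every block has rank $1$. $\mathcal{F}$ is balanced if for every $F\in\langle\mathcal{F}\rangle_\#$ of arity $n\ge2$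 and every $0<k<n$, the $|D|^k\times|D|^{n-k}$ matrix with entries $F((x_1,\dots,x_k),(x_{k+1},\dots,x_n))$ has block-rank $1$. -}

module Defs where

open import Data.Nat using (ℕ; zero; suc; _+_; _<_; _≤_)
open import Data.Fin using (Fin; zero; suc; _≟_)
open import Data.Rational using (ℚ; 0ℚ; 1ℚ) renaming (_+_ to _+ℚ_; _*_ to _*ℚ_; _≤_ to _≤ℚ_)
open import Data.Vec.Functional using (_∷_; _++_)
open import Data.List using (List; []; foldr)
open import Data.List.Membership.Propositional using (_∈_)
open import Data.List.Relation.Unary.All using (All)
open import Data.Product using (Σ; ∃; ∃-syntax; _×_; _,_)
open import Data.Sum using (_⊎_; inj₁; inj₂)
open import Data.Empty using (⊥)
open import Relation.Nullary using (¬_; yes; no)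
open import Relation.Binary.PropositionalEquality using (_≡_; _≢_)
open import Relation.Binary.Construct.Closure.ReflexiveTransitive using (Star)

Fun : ℕ → ℕ → Set
Fun d k = (Fin k → Fin d) → ℚ

Lang : ℕ → Set₁
Lang d = (k : ℕ) → Fun d k → Set

NonNeg : ∀ {d k} → Fun d k → Set
NonNeg f = ∀ x → 0ℚ ≤ℚ f x

listLang : ∀ {d} → List (Σ ℕ (Fun d)) → Lang d
listLang S k f = (k , f) ∈ S

_∪_ : ∀ {d} → Lang d → Lang d → Lang d
(L ∪ M) k f = L k f ⊎ M k f

_⊆L_ : ∀ {d} → Lang d → Lang d → Set
L ⊆L M = ∀ k f → L k f → M k f

B1 : ∀ d → Lang d
B1 d k f = (k ≡ 1) × NonNeg f

2ℚ : ℚ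
2ℚ = 1ℚ +ℚ 1ℚ

B1' : ∀ d → Lang d
B1' d k f = (k ≡ 1) × (∀ x → (f x ≡ 1ℚ) ⊎ (f x ≡ 2ℚ))

sumFin : ∀ d → (Fin d → ℚ) → ℚ
sumFin zero    g = 0ℚ
sumFin (suc d) g = g zero +ℚ sumFin d (λ i → g (suc i))

sumAll : ∀ d k → ((Fin k → Fin d) → ℚ) → ℚ
sumAll d zero    g = g (λ ())
sumAll d (suc k) g = sumFin d (λ a → sumAll d k (λ xs → g (a ∷ xs)))

EQ : ∀ {d} → Fun d 2
EQ x with x zero ≟ x (suc zero)
... | yes _ = 1ℚ
... | no  _ = 0ℚ

data Atom {d} (L : Lang d) (m : ℕ) : Set where
  app : (k : ℕ) (f : Fun d k) → L k f → (Fin k → Fin m) → Atom L m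
  eq  : Fin m → Fin m → Atom L m

evalAtom : ∀ {d} {L : Lang d} {m} → Atom L m → (Fin m → Fin d) → ℚ
evalAtom (app k f _ σ) x = f (λ i → x (σ i))
evalAtom (eq i j)      x = EQ (x i ∷ (x j ∷ (λ ())))

-- A pps-formula with n free variables: a number b of bound variables and
-- a finite list of atoms over the n + b variables (free ones first).
record PPS {d} (L : Lang d) (n : ℕ) : Set₁ where
  field
    bound : ℕ
    atoms : List (Atom L (n + bound))

open PPS public

⟦_⟧ : ∀ {d} {L : Lang d} {n} → PPS L n → Fun d n
⟦_⟧ {d} φ x =
  sumAll d (bound φ) (λ y →
    foldr (λ a r → evalAtom a (x ++ y) *ℚ r) 1ℚ (atoms φ))

InClone : ∀ {d} → Lang d → (n : ℕ) → Fun d n → Set₁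
InClone L n F = Σ (PPS L n) (λ φ → ∀ x → ⟦ φ ⟧ x ≡ F x)

Adj : ∀ {R C : Set} → (R → C → ℚ) → R ⊎ C → R ⊎ C → Set
Adj M (inj₁ r) (inj₂ c) = M r c ≢ 0ℚ
Adj M (inj₂ c) (inj₁ r) = M r c ≢ 0ℚ
Adj M (inj₁ _) (inj₁ _) = ⊥
Adj M (inj₂ _) (inj₂ _) = ⊥

Connected : ∀ {R C : Set} → (R → C → ℚ) → R ⊎ C → R ⊎ C → Set
Connected M = Star (Adj M)

-- Every block (connected component containing an edge (r₀,c₀)) has rank 1,
-- i.e. it is an outer product u vᵀ (nonzero since M r₀ c₀ ≠ 0).
BlockRank1 : ∀ {R C : Set} → (R → C → ℚ) → Set
BlockRank1 {R} {C} M =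
  ∀ r₀ c₀ → M r₀ c₀ ≢ 0ℚ →
  Σ (R → ℚ) λ u → Σ (C → ℚ) λ v →
    ∀ r c → Connected M (inj₁ r₀) (inj₁ r) → Connected M (inj₁ r₀) (inj₂ c) →
      M r c ≡ u r *ℚ v c

Balanced : ∀ {d} → Lang d → Set₁
Balanced {d} L =
  ∀ k m → 0 < k → 0 < m → (F : Fun d (k + m)) → InClone L (k + m) F →
    BlockRank1 {Fin k → Fin d} {Fin m → Fin d} (λ x y → F (x ++ y))

-- Balancedness passes to sublanguages (relabel the atoms of a pps-formula), and it can be
-- checked on finite sublanguages (a pps-formula mentions finitely many functions); this
-- gives every implication except B₁′ ⇒ B₁, which is proved by interpolation:
--   * block-rank 1 is equivalent to LocalRank1: two rows sharing a nonzero column are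
--     proportional, a condition on the 2×2 minors (MinorAt);
--   * unary functions whose values are products of four numbers from {1, 2} factorise into
--     functions of B₁′, so H ∪ B₁′ balanced gives H ∪ B1-products 4 balanced;
--   * in a formula over H ∪ B₁, replacing one value v of one unary atom by a parameter t
--     makes the matrix entries affine in t, so MinorAt becomes the vanishing of a polynomial
--     of degree ≤ 4 in t. It holds at the five values 1, 2, 4, 8, 16 (by induction), hence
--     everywhere, in particular at t = v. Iterating over the finitely many values and atoms
--     that matter transfers LocalRank1 from H ∪ B1-products 4 to H ∪ B₁.

module Submission where

open import Defs
open import Data.Vec.Functional using (_++_) renaming (_∷_ to _∷ᶠ_)
import Data.Nat as ℕ
open import Data.Nat using (ℕ; zero; suc; _<_; _≤_)
open import Function.Bundles using (_⇔_; mk⇔)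
open import Data.Fin using (Fin; zero; suc)
open import Data.Rational using (ℚ; 0ℚ; 1ℚ; _+_; _*_; _-_; 1/_; ≢-nonZero) renaming (_≤_ to _≤ℚ_)
open import Data.Rational.Properties
  using (_≟_; nonNegative⁻¹; +-*-commutativeRing; +-0-group; *-identityˡ; *-inverseˡ; *-assoc; *-zeroʳ; *-identityʳ; *-zeroˡ; +-identityˡ; +-assoc; *-comm)
open import Algebra.Properties.Group +-0-group using (x∙y⁻¹≈ε⇒x≈y; x≈y⇒x∙y⁻¹≈ε)
open import Data.Vec using (Vec; []; _∷_; replicate; zipWith)
open import Data.List using (List; []; _∷_; length; foldr; map; concatMap; allFin)
open import Data.List.Membership.Propositional.Properties using (∈-map⁺; ∈-concat⁺′; ∈-allFin)
open import Data.List.Membership.DecPropositional _≟_ using (_∈?_)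
open import Data.List.Relation.Unary.All as All using (All; []; _∷_)
open import Data.List.Relation.Unary.AllPairs using (AllPairs; []; _∷_)
open import Data.Maybe using (Maybe; just; nothing)
open import Data.Sum using (_⊎_; inj₁; inj₂; [_,_])
open import Data.Product using (Σ; _,_; _×_; proj₁; proj₂)
open import Data.List.Membership.Propositional using (_∈_)
open import Data.List.Relation.Unary.Any using (here; there)
open import Relation.Nullary using (yes; no; contradiction)
open import Relation.Binary.PropositionalEquality hiding ([_])
open import Relation.Binary.Construct.Closure.ReflexiveTransitive using (ε; _◅_; _◅◅_)
open import Function using (_∘_; id)
open import Tactic.RingSolver using (solve-∀)
open import Tactic.RingSolver.Core.AlmostCommutativeRing using (AlmostCommutativeRing; fromCommutativeRing)

open ≡-Reasoning

ℚ-ring : AlmostCommutativeRing _ _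
ℚ-ring = fromCommutativeRing +-*-commutativeRing isZero
  where
    isZero : ∀ x → Maybe (0ℚ ≡ x)
    isZero x with 0ℚ ≟ x
    ... | yes 0≡x = just 0≡x
    ... | no _    = nothing

zero-product : ∀ x y → x * y ≡ 0ℚ → x ≡ 0ℚ ⊎ y ≡ 0ℚ
zero-product x y xy≡0 with x ≟ 0ℚ
... | yes x≡0 = inj₁ x≡0
... | no  x≢0 = inj₂ (begin
  y                ≡⟨ sym (*-identityˡ y) ⟩
  1ℚ * y           ≡⟨ cong (_* y) (sym (*-inverseˡ x)) ⟩
  (1/ x * x) * y   ≡⟨ *-assoc (1/ x) x y ⟩
  1/ x * (x * y)   ≡⟨ cong (1/ x *_) xy≡0 ⟩
  1/ x * 0ℚ        ≡⟨ *-zeroʳ (1/ x) ⟩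
  0ℚ               ∎)
  where instance _ = ≢-nonZero x≢0

*-cancelʳ : ∀ {x y z} → y ≢ 0ℚ → x * y ≡ z * y → x ≡ z
*-cancelʳ {x} {y} {z} y≢0 xy≡zy = conclude (zero-product (x - z) y difference-zero)
  where
    distrib : ∀ x y z → (x - z) * y ≡ x * y - z * y
    distrib = solve-∀ ℚ-ring
    difference-zero : (x - z) * y ≡ 0ℚ
    difference-zero = trans (distrib x y z) (x≈y⇒x∙y⁻¹≈ε xy≡zy)
    conclude : x - z ≡ 0ℚ ⊎ y ≡ 0ℚ → x ≡ z
    conclude (inj₁ x-z≡0) = x∙y⁻¹≈ε⇒x≈y x z x-z≡0
    conclude (inj₂ y≡0)   = contradiction y≡0 y≢0

nonzero-product : ∀ {x y} → x ≢ 0ℚ → y ≢ 0ℚ → x * y ≢ 0ℚ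
nonzero-product {x} {y} x≢0 y≢0 xy≡0 with zero-product x y xy≡0
... | inj₁ x≡0 = x≢0 x≡0
... | inj₂ y≡0 = y≢0 y≡0

zeroˡ-* : ∀ {x} y → x ≡ 0ℚ → x * y ≡ 0ℚ
zeroˡ-* y x≡0 = trans (cong (_* y) x≡0) (*-zeroˡ y)

zeroʳ-* : ∀ x {y} → y ≡ 0ℚ → x * y ≡ 0ℚ
zeroʳ-* x y≡0 = trans (cong (x *_) y≡0) (*-zeroʳ x)

eval : ∀ {n} → Vec ℚ n → ℚ → ℚ
eval []       t = 0ℚ
eval (c ∷ cs) t = c + t * eval cs t

-- e is a polynomial function with (at most) n coefficients, i.e. of degree < n.
Poly : ℕ → (ℚ → ℚ) → Set
Poly n e = Σ (Vec ℚ n) λ cs → ∀ t → e t ≡ eval cs t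

-- Synthetic division: the quotient of the polynomial c ∷ cs by (t − p).
divide : ∀ {n} → ℚ → Vec ℚ n → Vec ℚ n
divide p []       = []
divide p (c ∷ cs) = eval (c ∷ cs) p ∷ divide p cs

factor : ∀ {n} p c (cs : Vec ℚ n) t →
  eval (c ∷ cs) t ≡ eval (c ∷ cs) p + (t - p) * eval (divide p cs) t
factor p c []        t = constant c t p
  where
    constant : ∀ c t p → c + t * 0ℚ ≡ (c + p * 0ℚ) + (t - p) * 0ℚ
    constant = solve-∀ ℚ-ring
factor p c (c′ ∷ cs) t = begin
  c + t * eval (c′ ∷ cs) t                                  ≡⟨ cong (λ e → c + t * e) (factor p c′ cs t) ⟩
  c + t * (eval (c′ ∷ cs) p + (t - p) * eval (divide p cs) t) ≡⟨ regroup c t p (eval (c′ ∷ cs) p) (eval (divide p cs) t) ⟩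
  (c + p * eval (c′ ∷ cs) p) + (t - p) * (eval (c′ ∷ cs) p + t * eval (divide p cs) t) ∎
  where
    regroup : ∀ c t p a q → c + t * (a + (t - p) * q) ≡ (c + p * a) + (t - p) * (a + t * q)
    regroup = solve-∀ ℚ-ring

quotient-root : ∀ {n} {p q} c (cs : Vec ℚ n) → q ≢ p →
  eval (c ∷ cs) p ≡ 0ℚ → eval (c ∷ cs) q ≡ 0ℚ → eval (divide p cs) q ≡ 0ℚ
quotient-root {p = p} {q} c cs q≢p Pp≡0 Pq≡0 = conclude (zero-product (q - p) (eval (divide p cs) q) scaled-zero)
  where
    scaled-zero : (q - p) * eval (divide p cs) q ≡ 0ℚ
    scaled-zero = begin
      (q - p) * eval (divide p cs) q                    ≡⟨ sym (+-identityˡ _) ⟩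
      0ℚ + (q - p) * eval (divide p cs) q               ≡⟨ cong (λ a → a + (q - p) * eval (divide p cs) q) (sym Pp≡0) ⟩
      eval (c ∷ cs) p + (q - p) * eval (divide p cs) q  ≡⟨ sym (factor p c cs q) ⟩
      eval (c ∷ cs) q                                   ≡⟨ Pq≡0 ⟩
      0ℚ                                                ∎
    conclude : q - p ≡ 0ℚ ⊎ eval (divide p cs) q ≡ 0ℚ → eval (divide p cs) q ≡ 0ℚ
    conclude (inj₁ q-p≡0) = contradiction (x∙y⁻¹≈ε⇒x≈y q p q-p≡0) q≢p
    conclude (inj₂ Qq≡0)  = Qq≡0

vanish : (ps : List ℚ) → AllPairs _≢_ ps → (cs : Vec ℚ (length ps)) →
  All (λ p → eval cs p ≡ 0ℚ) ps → ∀ t → eval cs t ≡ 0ℚ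
vanish []       []                  []       []               t = refl
vanish (p ∷ ps) (p≢ps ∷ ps-distinct) (c ∷ cs) (Pp≡0 ∷ Pps≡0) t = begin
  eval (c ∷ cs) t                                   ≡⟨ factor p c cs t ⟩
  eval (c ∷ cs) p + (t - p) * eval (divide p cs) t  ≡⟨ cong₂ (λ a e → a + (t - p) * e) Pp≡0 quotient-zero ⟩
  0ℚ + (t - p) * 0ℚ                                 ≡⟨ zero-sum (t - p) ⟩
  0ℚ                                                ∎
  where
    quotient-zero : eval (divide p cs) t ≡ 0ℚ
    quotient-zero = vanish ps ps-distinct (divide p cs)
      (All.zipWith (λ (p≢q , Pq≡0) → quotient-root c cs (p≢q ∘ sym) Pp≡0 Pq≡0) (p≢ps , Pps≡0)) t
    zero-sum : ∀ x → 0ℚ + x * 0ℚ ≡ 0ℚ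
    zero-sum = solve-∀ ℚ-ring

poly-vanish : ∀ {e} (ps : List ℚ) → AllPairs _≢_ ps → Poly (length ps) e →
  All (λ p → e p ≡ 0ℚ) ps → ∀ t → e t ≡ 0ℚ
poly-vanish ps distinct (cs , e≡P) roots t =
  trans (e≡P t) (vanish ps distinct cs (All.map (λ {p} ep≡0 → trans (sym (e≡P p)) ep≡0) roots) t)

poly-zero : ∀ n → Poly n (λ _ → 0ℚ)
poly-zero n = replicate n 0ℚ , λ t → sym (eval-zeros n t)
  where
    eval-zeros : ∀ n t → eval (replicate n 0ℚ) t ≡ 0ℚ
    eval-zeros zero    t = refl
    eval-zeros (suc n) t = trans (cong (λ e → 0ℚ + t * e) (eval-zeros n t)) (zero-sum t)
      where
        zero-sum : ∀ t → 0ℚ + t * 0ℚ ≡ 0ℚ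
        zero-sum = solve-∀ ℚ-ring

poly-constant : ∀ n k → Poly (suc n) (λ _ → k)
poly-constant n k = k ∷ proj₁ zeros , λ t → sym (begin
  k + t * eval (proj₁ zeros) t  ≡⟨ cong (λ e → k + t * e) (sym (proj₂ zeros t)) ⟩
  k + t * 0ℚ                    ≡⟨ drop-zero k t ⟩
  k                             ∎)
  where
    zeros = poly-zero n
    drop-zero : ∀ k t → k + t * 0ℚ ≡ k
    drop-zero = solve-∀ ℚ-ring

poly-linear : ∀ k → Poly 2 (λ t → t * k)
poly-linear k = 0ℚ ∷ k ∷ [] , linear k
  where
    linear : ∀ k t → t * k ≡ 0ℚ + t * (k + t * 0ℚ)
    linear = solve-∀ ℚ-ring

poly-+ : ∀ {n e f} → Poly n e → Poly n f → Poly n (λ t → e t + f t)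
poly-+ (as , e≡A) (bs , f≡B) = zipWith _+_ as bs , λ t → trans (cong₂ _+_ (e≡A t) (f≡B t)) (sym (eval-+ as bs t))
  where
    eval-+ : ∀ {n} (as bs : Vec ℚ n) t → eval (zipWith _+_ as bs) t ≡ eval as t + eval bs t
    eval-+ []       []       t = solve-∀ ℚ-ring
    eval-+ (a ∷ as) (b ∷ bs) t = trans (cong (λ e → (a + b) + t * e) (eval-+ as bs t)) (regroup a b t (eval as t) (eval bs t))
      where
        regroup : ∀ a b t A B → (a + b) + t * (A + B) ≡ (a + t * A) + (b + t * B)
        regroup = solve-∀ ℚ-ring

poly-- : ∀ {n e f} → Poly n e → Poly n f → Poly n (λ t → e t - f t)
poly-- (as , e≡A) (bs , f≡B) = zipWith _-_ as bs , λ t → trans (cong₂ _-_ (e≡A t) (f≡B t)) (sym (eval-- as bs t))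
  where
    eval-- : ∀ {n} (as bs : Vec ℚ n) t → eval (zipWith _-_ as bs) t ≡ eval as t - eval bs t
    eval-- []       []       t = solve-∀ ℚ-ring
    eval-- (a ∷ as) (b ∷ bs) t = trans (cong (λ e → (a - b) + t * e) (eval-- as bs t)) (regroup a b t (eval as t) (eval bs t))
      where
        regroup : ∀ a b t A B → (a - b) + t * (A - B) ≡ (a + t * A) - (b + t * B)
        regroup = solve-∀ ℚ-ring

mul-affine : ∀ {n} → ℚ → ℚ → Vec ℚ n → Vec ℚ (suc n)
mul-affine a b []       = 0ℚ ∷ []
mul-affine a b (c ∷ cs) with mul-affine a b cs
... | c′ ∷ cs′ = a * c ∷ (b * c + c′) ∷ cs′

eval-mul-affine : ∀ {n} a b (cs : Vec ℚ n) t → eval (mul-affine a b cs) t ≡ (a + b * t) * eval cs t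
eval-mul-affine a b []       t = both-zero a b t
  where
    both-zero : ∀ a b t → 0ℚ + t * 0ℚ ≡ (a + b * t) * 0ℚ
    both-zero = solve-∀ ℚ-ring
eval-mul-affine a b (c ∷ cs) t with mul-affine a b cs | eval-mul-affine a b cs t
... | c′ ∷ cs′ | IH = begin
  a * c + t * ((b * c + c′) + t * eval cs′ t)  ≡⟨ cong (λ e → a * c + t * e) (+-assoc (b * c) c′ (t * eval cs′ t)) ⟩
  a * c + t * (b * c + (c′ + t * eval cs′ t))  ≡⟨ cong (λ e → a * c + t * (b * c + e)) IH ⟩
  a * c + t * (b * c + (a + b * t) * eval cs t) ≡⟨ regroup a b c t (eval cs t) ⟩
  (a + b * t) * (c + t * eval cs t)            ∎
  where
    regroup : ∀ a b c t E → a * c + t * (b * c + (a + b * t) * E) ≡ (a + b * t) * (c + t * E)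
    regroup = solve-∀ ℚ-ring

poly-*-affine : ∀ {n f e} → Poly 2 f → Poly n e → Poly (suc n) (λ t → f t * e t)
poly-*-affine {f = f} {e} (a ∷ b ∷ [] , f≡ab) (cs , e≡C) = mul-affine a b cs , λ t → begin
  f t * e t                          ≡⟨ cong₂ _*_ (f≡ab t) (e≡C t) ⟩
  (a + t * (b + t * 0ℚ)) * eval cs t ≡⟨ cong (_* eval cs t) (normalise a b t) ⟩
  (a + b * t) * eval cs t            ≡⟨ sym (eval-mul-affine a b cs t) ⟩
  eval (mul-affine a b cs) t         ∎
  where
    normalise : ∀ a b t → a + t * (b + t * 0ℚ) ≡ a + b * t
    normalise = solve-∀ ℚ-ring

poly-sumFin : ∀ {n} d {g : Fin d → ℚ → ℚ} → (∀ a → Poly n (g a)) → Poly n (λ t → sumFin d (λ a → g a t))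
poly-sumFin zero    P = poly-zero _
poly-sumFin (suc d) P = poly-+ (P zero) (poly-sumFin d (λ a → P (suc a)))

poly-sumAll : ∀ {n} d b {g : (Fin b → Fin d) → ℚ → ℚ} → (∀ z → Poly n (g z)) →
  Poly n (λ t → sumAll d b (λ z → g z t))
poly-sumAll d zero    P = P (λ ())
poly-sumAll d (suc b) P = poly-sumFin d (λ a → poly-sumAll d b (λ z → P (a ∷ᶠ z)))

MinorAt : ∀ {R C : Set} → (R → C → ℚ) → R → R → C → C → C → Set
MinorAt M r r′ c c′ c″ = M r c″ * M r′ c″ ≡ 0ℚ ⊎ M r c * M r′ c′ ≡ M r c′ * M r′ c

-- MinorAt as the vanishing of a single product, which is polynomial in the entries.
minor-product : ∀ {R C : Set} → (R → C → ℚ) → R → R → C → C → C → ℚ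
minor-product M r r′ c c′ c″ = M r c″ * (M r′ c″ * (M r c * M r′ c′ - M r c′ * M r′ c))

minor⇒product : ∀ {R C : Set} {M : R → C → ℚ} {r r′ c c′ c″} →
  MinorAt M r r′ c c′ c″ → minor-product M r r′ c c′ c″ ≡ 0ℚ
minor⇒product {M = M} {r} {r′} {c} {c′} {c″} (inj₁ rc″r′c″≡0) = begin
  M r c″ * (M r′ c″ * D)   ≡⟨ sym (*-assoc (M r c″) (M r′ c″) D) ⟩
  (M r c″ * M r′ c″) * D   ≡⟨ zeroˡ-* D rc″r′c″≡0 ⟩
  0ℚ                       ∎
  where D = M r c * M r′ c′ - M r c′ * M r′ c
minor⇒product {M = M} {r} {r′} {c} {c′} {c″} (inj₂ minor) =
  zeroʳ-* (M r c″) (zeroʳ-* (M r′ c″) (x≈y⇒x∙y⁻¹≈ε minor))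

product⇒minor : ∀ {R C : Set} {M : R → C → ℚ} {r r′ c c′ c″} →
  minor-product M r r′ c c′ c″ ≡ 0ℚ → MinorAt M r r′ c c′ c″
product⇒minor {M = M} {r} {r′} {c} {c′} {c″} product≡0 = split (zero-product (M r c″) _ product≡0)
  where
    D = M r c * M r′ c′ - M r c′ * M r′ c
    split : M r c″ ≡ 0ℚ ⊎ M r′ c″ * D ≡ 0ℚ → MinorAt M r r′ c c′ c″
    split (inj₁ rc″≡0)  = inj₁ (zeroˡ-* (M r′ c″) rc″≡0)
    split (inj₂ rest≡0) with zero-product (M r′ c″) D rest≡0
    ... | inj₁ r′c″≡0 = inj₁ (zeroʳ-* (M r c″) r′c″≡0)
    ... | inj₂ D≡0    = inj₂ (x∙y⁻¹≈ε⇒x≈y _ _ D≡0)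

-- Interpolation: let the entries of a matrix depend affinely on a parameter t. If the
-- condition MinorAt holds at five distinct values of t, then it holds for every t,
-- because the product minor-product is then a polynomial of degree ≤ 4 with five roots.
minor-interpolation : ∀ {R C : Set} {M : ℚ → R → C → ℚ} {ps : List ℚ} →
  AllPairs _≢_ ps → length ps ≡ 5 → (∀ x y → Poly 2 (λ t → M t x y)) →
  ∀ {r r′ c c′ c″} → All (λ t → MinorAt (M t) r r′ c c′ c″) ps → ∀ t → MinorAt (M t) r r′ c c′ c″
minor-interpolation {M = M} {ps} distinct |ps|≡5 affine {r} {r′} {c} {c′} {c″} holds t =
  product⇒minor {M = M t} (poly-vanish ps distinct quartic (All.map (minor⇒product {M = M _}) holds) t)
  where
    quartic : Poly (length ps) (λ t → minor-product (M t) r r′ c c′ c″)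
    quartic = subst (λ n → Poly n (λ t → minor-product (M t) r r′ c c′ c″)) (sym |ps|≡5)
      (poly-*-affine (affine r c″) (poly-*-affine (affine r′ c″)
        (poly-- (poly-*-affine (affine r c) (affine r′ c′)) (poly-*-affine (affine r c′) (affine r′ c)))))

-- MinorAt depends only on six entries of the matrix.
entries : ∀ {R C : Set} → R → R → C → C → C → List (R × C)
entries r r′ c c′ c″ = (r , c″) ∷ (r′ , c″) ∷ (r , c) ∷ (r′ , c′) ∷ (r , c′) ∷ (r′ , c) ∷ []

minorAt-local : ∀ {R C : Set} {M N : R → C → ℚ} {r r′ c c′ c″} →
  (∀ {x y} → (x , y) ∈ entries r r′ c c′ c″ → M x y ≡ N x y) →
  MinorAt M r r′ c c′ c″ → MinorAt N r r′ c c′ c″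
minorAt-local agree (inj₁ product≡0) =
  inj₁ (trans (sym (cong₂ _*_ (agree (here refl)) (agree (there (here refl))))) product≡0)
minorAt-local agree (inj₂ minor) = inj₂ (begin
  _ ≡⟨ sym (cong₂ _*_ (agree (there (there (here refl)))) (agree (there (there (there (here refl)))))) ⟩
  _ ≡⟨ minor ⟩
  _ ≡⟨ cong₂ _*_ (agree (there (there (there (there (here refl)))))) (agree (there (there (there (there (there (here refl))))))) ⟩
  _ ∎)

minorAt-cong : ∀ {R C : Set} {M N : R → C → ℚ} → (∀ x y → M x y ≡ N x y) →
  ∀ {r r′ c c′ c″} → MinorAt M r r′ c c′ c″ → MinorAt N r r′ c c′ c″
minorAt-cong M≗N = minorAt-local (λ {x} {y} _ → M≗N x y)

-- Local rank one: any two rows meeting a common nonzero column are proportional.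
LocalRank1 : ∀ {R C : Set} → (R → C → ℚ) → Set
LocalRank1 M = ∀ r r′ c c′ c″ → MinorAt M r r′ c c′ c″

localRank1-cong : ∀ {R C : Set} {M N : R → C → ℚ} → (∀ x y → M x y ≡ N x y) → LocalRank1 M → LocalRank1 N
localRank1-cong M≗N local r r′ c c′ c″ = minorAt-cong M≗N (local r r′ c c′ c″)

module _ {R C : Set} (M : R → C → ℚ) where

  rows-linked : ∀ {r r′ c} → M r c ≢ 0ℚ → M r′ c ≢ 0ℚ → Connected M (inj₁ r) (inj₁ r′)
  rows-linked {c = c} rc≢0 r′c≢0 = _◅_ {j = inj₂ c} rc≢0 (r′c≢0 ◅ ε)

  column-of-block : ∀ {r r′ c″} → M r c″ ≢ 0ℚ → M r′ c″ ≢ 0ℚ → ∀ c →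
    (M r c ≡ 0ℚ × M r′ c ≡ 0ℚ) ⊎ Connected M (inj₁ r) (inj₂ c)
  column-of-block {r} {r′} {c″} rc″≢0 r′c″≢0 c with M r c ≟ 0ℚ | M r′ c ≟ 0ℚ
  ... | no  rc≢0  | _          = inj₂ (rc≢0 ◅ ε)
  ... | yes _     | no r′c≢0   = inj₂ (rows-linked rc″≢0 r′c″≢0 ◅◅ (r′c≢0 ◅ ε))
  ... | yes rc≡0  | yes r′c≡0  = inj₁ (rc≡0 , r′c≡0)

  -- Block-rank 1 implies local rank 1: two rows sharing a nonzero column lie in one block,
  -- where the matrix is an outer product u vᵀ; columns outside the block are zero on both.
  blockRank1⇒localRank1 : BlockRank1 M → LocalRank1 M
  blockRank1⇒localRank1 rank1 r r′ c c′ c″ with M r c″ * M r′ c″ ≟ 0ℚ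
  ... | yes product≡0 = inj₁ product≡0
  ... | no  product≢0 = inj₂ (minor (column-of-block rc″≢0 r′c″≢0 c) (column-of-block rc″≢0 r′c″≢0 c′))
    where
      rc″≢0 : M r c″ ≢ 0ℚ
      rc″≢0 rc″≡0 = product≢0 (zeroˡ-* (M r′ c″) rc″≡0)
      r′c″≢0 : M r′ c″ ≢ 0ℚ
      r′c″≢0 r′c″≡0 = product≢0 (zeroʳ-* (M r c″) r′c″≡0)
      r↝r′ : Connected M (inj₁ r) (inj₁ r′)
      r↝r′ = rows-linked rc″≢0 r′c″≢0
      u = proj₁ (rank1 r c″ rc″≢0)
      v = proj₁ (proj₂ (rank1 r c″ rc″≢0))
      M≡uv = proj₂ (proj₂ (rank1 r c″ rc″≢0))
      swap : ∀ a b x y → (a * x) * (b * y) ≡ (a * y) * (b * x)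
      swap = solve-∀ ℚ-ring
      minor : (M r c ≡ 0ℚ × M r′ c ≡ 0ℚ) ⊎ Connected M (inj₁ r) (inj₂ c) →
              (M r c′ ≡ 0ℚ × M r′ c′ ≡ 0ℚ) ⊎ Connected M (inj₁ r) (inj₂ c′) →
              M r c * M r′ c′ ≡ M r c′ * M r′ c
      minor (inj₁ (rc≡0 , r′c≡0)) _          = trans (zeroˡ-* (M r′ c′) rc≡0) (sym (zeroʳ-* (M r c′) r′c≡0))
      minor (inj₂ _) (inj₁ (rc′≡0 , r′c′≡0)) = trans (zeroʳ-* (M r c) r′c′≡0) (sym (zeroˡ-* (M r′ c) rc′≡0))
      minor (inj₂ r↝c) (inj₂ r↝c′) = begin
        M r c * M r′ c′             ≡⟨ cong₂ _*_ (M≡uv r c ε r↝c) (M≡uv r′ c′ r↝r′ r↝c′) ⟩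
        (u r * v c) * (u r′ * v c′) ≡⟨ swap (u r) (u r′) (v c) (v c′) ⟩
        (u r * v c′) * (u r′ * v c) ≡⟨ sym (cong₂ _*_ (M≡uv r c′ ε r↝c′) (M≡uv r′ c r↝r′ r↝c)) ⟩
        M r c′ * M r′ c             ∎

_∥_ : ∀ {C : Set} → (C → ℚ) → (C → ℚ) → Set
x ∥ y = ∀ a b → x a * y b ≡ x b * y a

∥-refl : ∀ {C : Set} (x : C → ℚ) → x ∥ x
∥-refl x a b = *-comm (x a) (x b)

∥-trans : ∀ {C : Set} {x y z : C → ℚ} {c} → y c ≢ 0ℚ → x ∥ y → y ∥ z → x ∥ z
∥-trans {x = x} {y} {z} {c} yc≢0 x∥y y∥z a b = *-cancelʳ yc≢0 (begin
  (x a * z b) * y c ≡⟨ rearrange (x a) (z b) (y c) ⟩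
  (x a * y c) * z b ≡⟨ cong (_* z b) (x∥y a c) ⟩
  (x c * y a) * z b ≡⟨ *-assoc (x c) (y a) (z b) ⟩
  x c * (y a * z b) ≡⟨ cong (x c *_) (y∥z a b) ⟩
  x c * (y b * z a) ≡⟨ sym (*-assoc (x c) (y b) (z a)) ⟩
  (x c * y b) * z a ≡⟨ cong (_* z a) (x∥y c b) ⟩
  (x b * y c) * z a ≡⟨ rearrange (x b) (y c) (z a) ⟩
  (x b * z a) * y c ∎)
  where
    rearrange : ∀ p q r → (p * q) * r ≡ (p * r) * q
    rearrange = solve-∀ ℚ-ring

module _ {R C : Set} {M : R → C → ℚ} (local : LocalRank1 M) (r₀ : R) where

  -- Along a path of the block graph starting at r₀, every row reached is proportional
  -- to r₀, and every column reached has a nonzero entry in such a row.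
  InBlock : R ⊎ C → Set
  InBlock (inj₁ r) = M r ∥ M r₀
  InBlock (inj₂ c) = Σ R λ r → M r ∥ M r₀ × M r c ≢ 0ℚ

  inBlock-step : ∀ {p q} → Adj M p q → InBlock p → InBlock q
  inBlock-step {inj₁ r} {inj₂ c} rc≢0 r∥r₀ = r , r∥r₀ , rc≢0
  inBlock-step {inj₂ c} {inj₁ r} rc≢0 (r′ , r′∥r₀ , r′c≢0) = ∥-trans {x = M r} {M r′} {M r₀} r′c≢0 r∥r′ r′∥r₀
    where
      r∥r′ : M r ∥ M r′
      r∥r′ a b with local r r′ a b c
      ... | inj₁ product≡0 = contradiction product≡0 (nonzero-product rc≢0 r′c≢0)
      ... | inj₂ minor     = minor

  inBlock-path : ∀ {p q} → Connected M p q → InBlock p → InBlock q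
  inBlock-path ε            inBlock = inBlock
  inBlock-path (edge ◅ path) inBlock = inBlock-path path (inBlock-step edge inBlock)

-- Conversely, local rank 1 gives block-rank 1: on the block of (r₀, c₀) the matrix is
-- M r c = M r c₀ · M r₀ c / M r₀ c₀.
localRank1⇒blockRank1 : ∀ {R C : Set} (M : R → C → ℚ) → LocalRank1 M → BlockRank1 M
localRank1⇒blockRank1 M local r₀ c₀ r₀c₀≢0 = u , v , factorise
  where
    instance _ = ≢-nonZero r₀c₀≢0
    u = λ r → M r c₀
    v = λ c → M r₀ c * 1/ M r₀ c₀
    factorise : ∀ r c → Connected M (inj₁ r₀) (inj₁ r) → Connected M (inj₁ r₀) (inj₂ c) → M r c ≡ u r * v c
    factorise r c r₀↝r _ = *-cancelʳ r₀c₀≢0 (begin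
      M r c * M r₀ c₀                             ≡⟨ inBlock-path local r₀ r₀↝r (∥-refl (M r₀)) c c₀ ⟩
      M r c₀ * M r₀ c                             ≡⟨ sym (*-identityʳ _) ⟩
      (M r c₀ * M r₀ c) * 1ℚ                      ≡⟨ cong ((M r c₀ * M r₀ c) *_) (sym (*-inverseˡ (M r₀ c₀))) ⟩
      (M r c₀ * M r₀ c) * (1/ M r₀ c₀ * M r₀ c₀)  ≡⟨ regroup (M r c₀) (M r₀ c) (1/ M r₀ c₀) (M r₀ c₀) ⟩
      (M r c₀ * (M r₀ c * 1/ M r₀ c₀)) * M r₀ c₀  ∎)
      where
        regroup : ∀ a b i m → (a * b) * (i * m) ≡ (a * (b * i)) * m
        regroup = solve-∀ ℚ-ring

sumFin-cong : ∀ n {g h : Fin n → ℚ} → (∀ a → g a ≡ h a) → sumFin n g ≡ sumFin n h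
sumFin-cong zero    g≗h = refl
sumFin-cong (suc n) g≗h = cong₂ _+_ (g≗h zero) (sumFin-cong n (λ a → g≗h (suc a)))

module _ {d : ℕ} where

  sumAll-cong : ∀ b {g h : (Fin b → Fin d) → ℚ} → (∀ z → g z ≡ h z) → sumAll d b g ≡ sumAll d b h
  sumAll-cong zero    g≗h = g≗h (λ ())
  sumAll-cong (suc b) g≗h = sumFin-cong d (λ a → sumAll-cong b (λ z → g≗h (a ∷ᶠ z)))

  -- The product of a list of atoms at an assignment of all variables, so that
  -- ⟦ φ ⟧ x = Σ_y weight (atoms φ) (x ++ y).
  weight : ∀ {L : Lang d} {m} → List (Atom L m) → (Fin m → Fin d) → ℚ
  weight As w = foldr (λ a r → evalAtom a w * r) 1ℚ As

  reformulate : ∀ {L M : Lang d} {n F} (φ : PPS L n) (As : List (Atom M (n ℕ.+ bound φ))) →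
    (∀ w → weight As w ≡ weight (atoms φ) w) → (∀ x → ⟦ φ ⟧ x ≡ F x) → InClone M n F
  reformulate φ As same-weight φ≗F =
    record { bound = bound φ ; atoms = As } ,
    λ x → trans (sumAll-cong (bound φ) (λ y → same-weight (x ++ y))) (φ≗F x)

  relabel : ∀ {L M : Lang d} {m} → L ⊆L M → Atom L m → Atom M m
  relabel L⊆M (app k f f∈L σ) = app k f (L⊆M k f f∈L) σ
  relabel L⊆M (eq i j)        = eq i j

  weight-relabel : ∀ {L M : Lang d} {m} (L⊆M : L ⊆L M) (As : List (Atom L m)) w →
    weight (map (relabel L⊆M) As) w ≡ weight As w
  weight-relabel L⊆M []                   w = refl
  weight-relabel L⊆M (app k f _ σ ∷ As)   w = cong (f (λ i → w (σ i)) *_) (weight-relabel L⊆M As w)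
  weight-relabel L⊆M (eq i j ∷ As)        w = cong (EQ (w i ∷ᶠ (w j ∷ᶠ (λ ()))) *_) (weight-relabel L⊆M As w)

  inClone-mono : ∀ {L M : Lang d} {n F} → L ⊆L M → InClone L n F → InClone M n F
  inClone-mono L⊆M (φ , φ≗F) = reformulate φ (map (relabel L⊆M) (atoms φ)) (weight-relabel L⊆M (atoms φ)) φ≗F

  balanced-antitone : ∀ {L M : Lang d} → L ⊆L M → Balanced M → Balanced L
  balanced-antitone L⊆M balanced k m 0<k 0<m F F∈⟨L⟩ = balanced k m 0<k 0<m F (inClone-mono L⊆M F∈⟨L⟩)

  support : ∀ {L : Lang d} {m} → List (Atom L m) → List (Σ ℕ (Fun d))
  support []                 = []
  support (app k f _ _ ∷ As) = (k , f) ∷ support As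
  support (eq _ _ ∷ As)      = support As

  support-⊆ : ∀ {L : Lang d} {m} (As : List (Atom L m)) → listLang (support As) ⊆L L
  support-⊆ (app k f f∈L _ ∷ As) .k .f (here refl) = f∈L
  support-⊆ (app _ _ _ _ ∷ As)   k  f  (there f∈S) = support-⊆ As k f f∈S
  support-⊆ (eq _ _ ∷ As)        k  f  f∈S         = support-⊆ As k f f∈S

  localise : ∀ {L : Lang d} {m} (As : List (Atom L m)) → List (Atom (listLang (support As)) m)
  localise []                 = []
  localise (app k f _ σ ∷ As) = app k f (here refl) σ ∷ map (relabel (λ _ _ → there)) (localise As)
  localise (eq i j ∷ As)      = eq i j ∷ localise As

  weight-localise : ∀ {L : Lang d} {m} (As : List (Atom L m)) w → weight (localise As) w ≡ weight As w
  weight-localise []                 w = refl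
  weight-localise (app k f _ σ ∷ As) w =
    cong (f (λ i → w (σ i)) *_) (trans (weight-relabel (λ _ _ → there) (localise As) w) (weight-localise As w))
  weight-localise (eq i j ∷ As)      w = cong (EQ (w i ∷ᶠ (w j ∷ᶠ (λ ()))) *_) (weight-localise As w)

  inClone-finite : ∀ {L : Lang d} {n F} → InClone L n F →
    Σ (List (Σ ℕ (Fun d))) λ S → listLang S ⊆L L × InClone (listLang S) n F
  inClone-finite (φ , φ≗F) =
    support (atoms φ) , support-⊆ (atoms φ) , reformulate φ (localise (atoms φ)) (weight-localise (atoms φ)) φ≗F

  balanced-from-finite : ∀ {L : Lang d} →
    ((S : List (Σ ℕ (Fun d))) → listLang S ⊆L L → Balanced (listLang S)) → Balanced L
  balanced-from-finite finite k m 0<k 0<m F F∈⟨L⟩ with inClone-finite F∈⟨L⟩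
  ... | S , S⊆L , F∈⟨S⟩ = finite S S⊆L k m 0<k 0<m F F∈⟨S⟩

  product : ∀ {k} → List (Fun d k) → Fun d k
  product gs x = foldr (λ g r → g x * r) 1ℚ gs

  Factorises : Lang d → (k : ℕ) → Fun d k → Set
  Factorises L k f = Σ (List (Fun d k)) λ gs → All (L k) gs × (∀ x → f x ≡ product gs x)

  apply-all : ∀ {L : Lang d} {k m} (gs : List (Fun d k)) → All (L k) gs →
    (Fin k → Fin m) → List (Atom L m) → List (Atom L m)
  apply-all []       []           σ As = As
  apply-all (g ∷ gs) (g∈L ∷ gs∈L) σ As = app _ g g∈L σ ∷ apply-all gs gs∈L σ As

  weight-apply-all : ∀ {L : Lang d} {k m} (gs : List (Fun d k)) (gs∈L : All (L k) gs) σ (As : List (Atom L m)) w →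
    weight (apply-all gs gs∈L σ As) w ≡ product gs (λ i → w (σ i)) * weight As w
  weight-apply-all []       []           σ As w = sym (*-identityˡ (weight As w))
  weight-apply-all (g ∷ gs) (_ ∷ gs∈L)   σ As w = begin
    g x * weight (apply-all gs gs∈L σ As) w   ≡⟨ cong (g x *_) (weight-apply-all gs gs∈L σ As w) ⟩
    g x * (product gs x * weight As w)        ≡⟨ sym (*-assoc (g x) (product gs x) (weight As w)) ⟩
    (g x * product gs x) * weight As w        ∎
    where x = λ i → w (σ i)

  -- If every function of M factorises over L, then ⟨M⟩ ⊆ ⟨L⟩: replace each atom by its factors.
  module _ {L M : Lang d} (factorise : ∀ k f → M k f → Factorises L k f) where

    expand : ∀ {m} → List (Atom M m) → List (Atom L m)
    expand []                     = []
    expand (app k f f∈M σ ∷ As) with factorise k f f∈M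
    ... | gs , gs∈L , _           = apply-all gs gs∈L σ (expand As)
    expand (eq i j ∷ As)          = eq i j ∷ expand As

    weight-expand : ∀ {m} (As : List (Atom M m)) w → weight (expand As) w ≡ weight As w
    weight-expand []                     w = refl
    weight-expand (app k f f∈M σ ∷ As) w with factorise k f f∈M
    ... | gs , gs∈L , f≗gs = trans (weight-apply-all gs gs∈L σ (expand As) w)
                                   (cong₂ _*_ (sym (f≗gs (λ i → w (σ i)))) (weight-expand As w))
    weight-expand (eq i j ∷ As)          w = cong (EQ (w i ∷ᶠ (w j ∷ᶠ (λ ()))) *_) (weight-expand As w)

    inClone-simulate : ∀ {n F} → InClone M n F → InClone L n F
    inClone-simulate (φ , φ≗F) = reformulate φ (expand (atoms φ)) (weight-expand (atoms φ)) φ≗F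

    balanced-simulate : Balanced L → Balanced M
    balanced-simulate balanced k m 0<k 0<m F F∈⟨M⟩ = balanced k m 0<k 0<m F (inClone-simulate F∈⟨M⟩)

One-or-two : ℚ → Set
One-or-two a = a ≡ 1ℚ ⊎ a ≡ 2ℚ

Product12 : ℕ → ℚ → Set
Product12 zero    v = v ≡ 1ℚ
Product12 (suc n) v = Σ ℚ λ a → Σ ℚ λ v′ → One-or-two a × Product12 n v′ × v ≡ a * v′

times1 : ∀ {n v} → Product12 n v → Product12 (suc n) v
times1 {v = v} p = 1ℚ , v , inj₁ refl , p , sym (*-identityˡ v)

times2 : ∀ {n v} → Product12 n v → Product12 (suc n) (2ℚ * v)
times2 {v = v} p = 2ℚ , v , inj₂ refl , p , refl

product12-one : ∀ n → Product12 n 1ℚ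
product12-one zero    = refl
product12-one (suc n) = times1 (product12-one n)

B1-products : ∀ d → ℕ → Lang d
B1-products d n k f = (k ≡ 1) × (∀ x → Product12 n (f x))

factorise-products : ∀ {d} n (f : Fun d 1) → (∀ x → Product12 n (f x)) → Factorises (B1' d) 1 f
factorise-products zero    f f≡1   = [] , [] , f≡1
factorise-products (suc n) f f∈P₁₂ = first ∷ gs , (refl , first∈B1') ∷ gs∈B1' , f≗
  where
    first rest : Fun _ 1
    first x = proj₁ (f∈P₁₂ x)
    rest  x = proj₁ (proj₂ (f∈P₁₂ x))
    first∈B1' : ∀ x → One-or-two (first x)
    first∈B1' x = proj₁ (proj₂ (proj₂ (f∈P₁₂ x)))
    rest-factorises : Factorises (B1' _) 1 rest
    rest-factorises = factorise-products n rest (λ x → proj₁ (proj₂ (proj₂ (proj₂ (f∈P₁₂ x)))))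
    gs = proj₁ rest-factorises
    gs∈B1' = proj₁ (proj₂ rest-factorises)
    f≗ : ∀ x → f x ≡ first x * product gs x
    f≗ x = trans (proj₂ (proj₂ (proj₂ (proj₂ (f∈P₁₂ x))))) (cong (first x *_) (proj₂ (proj₂ rest-factorises) x))

sample-points : List ℚ
sample-points = 1ℚ ∷ 2ℚ ∷ 2ℚ * 2ℚ ∷ 2ℚ * (2ℚ * 2ℚ) ∷ 2ℚ * (2ℚ * (2ℚ * 2ℚ)) ∷ []

sample-distinct : AllPairs _≢_ sample-points
sample-distinct = ((λ ()) ∷ (λ ()) ∷ (λ ()) ∷ (λ ()) ∷ []) ∷ ((λ ()) ∷ (λ ()) ∷ (λ ()) ∷ []) ∷
                  ((λ ()) ∷ (λ ()) ∷ []) ∷ ((λ ()) ∷ []) ∷ [] ∷ []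

sample-products : All (Product12 4) sample-points
sample-products = product12-one 4 ∷ times2 (product12-one 3) ∷ times2 (times2 (product12-one 2)) ∷
                  times2 (times2 (times2 (product12-one 1))) ∷ times2 (times2 (times2 (times2 refl))) ∷ []

-- The matrix of a weight function on assignments to k + m + b variables: rows and
-- columns assign the first k and the next m variables, the last b are summed out.
matrix : ∀ {d k m} b → ((Fin (k ℕ.+ m ℕ.+ b) → Fin d) → ℚ) → (Fin k → Fin d) → (Fin m → Fin d) → ℚ
matrix {d} b ω x y = sumAll d b (λ z → ω ((x ++ y) ++ z))

matrix-cong : ∀ {d k m} b {ω ω′ : (Fin (k ℕ.+ m ℕ.+ b) → Fin d) → ℚ} → (∀ w → ω w ≡ ω′ w) →
  ∀ (x : Fin k → Fin d) (y : Fin m → Fin d) → matrix b ω x y ≡ matrix b ω′ x y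
matrix-cong b ω≗ω′ x y = sumAll-cong b (λ z → ω≗ω′ ((x ++ y) ++ z))

-- An explicit list of all assignments, so that a sum only depends on the listed points.
assignments : ∀ d b → List (Fin b → Fin d)
assignments d zero    = (λ ()) ∷ []
assignments d (suc b) = concatMap (λ a → map (a ∷ᶠ_) (assignments d b)) (allFin d)

sumAll-local : ∀ {d} b {g h : (Fin b → Fin d) → ℚ} → (∀ z → z ∈ assignments d b → g z ≡ h z) →
  sumAll d b g ≡ sumAll d b h
sumAll-local         zero    g≗h = g≗h (λ ()) (here refl)
sumAll-local {d = d} (suc b) g≗h = sumFin-cong d (λ a → sumAll-local b (λ z z∈ →
  g≗h (a ∷ᶠ z) (∈-concat⁺′ (∈-map⁺ (a ∷ᶠ_) z∈) (∈-map⁺ (λ a → map (a ∷ᶠ_) (assignments d b)) (∈-allFin a)))))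

-- The weight is f(position w) · ρ(w) for a
-- unary function f; if the 2×2 condition holds whenever f takes values in Product12 4,
-- it holds for every f.
module UnaryInterpolation {d k m b : ℕ} {A : Set}
  (position : (Fin (k ℕ.+ m ℕ.+ b) → Fin d) → A) (ρ : (Fin (k ℕ.+ m ℕ.+ b) → Fin d) → ℚ)
  (r r′ : Fin k → Fin d) (c c′ c″ : Fin m → Fin d) where

  weighted : (A → ℚ) → (Fin k → Fin d) → (Fin m → Fin d) → ℚ
  weighted f = matrix b (λ w → f (position w) * ρ w)

  Good : (A → ℚ) → Set
  Good f = MinorAt (weighted f) r r′ c c′ c″

  good-cong : ∀ {f g} → (∀ a → f a ≡ g a) → Good f → Good g
  good-cong f≗g = minorAt-cong (matrix-cong {k = k} {m} b (λ w → cong (_* ρ w) (f≗g (position w))))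

  replace : ℚ → ℚ → (A → ℚ) → A → ℚ
  replace v t f a with f a ≟ v
  ... | yes _ = t
  ... | no  _ = f a

  replace-self : ∀ v f a → replace v v f a ≡ f a
  replace-self v f a with f a ≟ v
  ... | yes fa≡v = sym fa≡v
  ... | no  _    = refl

  replace-affine : ∀ v f x y → Poly 2 (λ t → weighted (replace v t f) x y)
  replace-affine v f x y = poly-sumAll d b (λ z → summand ((x ++ y) ++ z))
    where
      summand : ∀ w → Poly 2 (λ t → replace v t f (position w) * ρ w)
      summand w with f (position w) ≟ v
      ... | yes _ = poly-linear (ρ w)
      ... | no  _ = poly-constant 1 (f (position w) * ρ w)

  module _ (good-on-products : ∀ f → (∀ a → Product12 4 (f a)) → Good f) where

    -- Induction on the list of values of f outside Product12 4: the first listed value v is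
    -- replaced by each of the five sample points; the condition holds there by induction,
    -- hence everywhere by interpolation, in particular at t = v.
    good-on-values : ∀ Vs f → (∀ a → Product12 4 (f a) ⊎ f a ∈ Vs) → Good f
    good-on-values []       f f∈P⊎Vs = good-on-products f (λ a → [ id , (λ ()) ] (f∈P⊎Vs a))
    good-on-values (v ∷ Vs) f f∈P⊎Vs =
      good-cong (replace-self v f) (minor-interpolation sample-distinct refl (replace-affine v f) at-samples v)
      where
        still-good : ∀ {t} → Product12 4 t → ∀ a → Product12 4 (replace v t f a) ⊎ replace v t f a ∈ Vs
        still-good t∈P a with f a ≟ v | f∈P⊎Vs a
        ... | yes _   | _                   = inj₁ t∈P
        ... | no  _   | inj₁ fa∈P           = inj₁ fa∈P
        ... | no fa≢v | inj₂ (here fa≡v)    = contradiction fa≡v fa≢v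
        ... | no  _   | inj₂ (there fa∈Vs)  = inj₂ fa∈Vs
        at-samples : All (λ t → Good (replace v t f)) sample-points
        at-samples = All.map (λ t∈P → good-on-values Vs (replace v _ f) (still-good t∈P)) sample-products

    -- A general f is first changed to 1 away from the finitely many values that the
    -- six relevant entries actually use.
    good : ∀ f → Good f
    good f = minorAt-local agree (good-on-values used truncated truncated-good)
      where
        values-at : (Fin k → Fin d) × (Fin m → Fin d) → List ℚ
        values-at (x , y) = map (λ z → f (position ((x ++ y) ++ z))) (assignments d b)
        used : List ℚ
        used = concatMap values-at (entries r r′ c c′ c″)
        truncated : A → ℚ
        truncated a with f a ∈? used
        ... | yes _ = f a
        ... | no  _ = 1ℚ
        truncated-good : ∀ a → Product12 4 (truncated a) ⊎ truncated a ∈ used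
        truncated-good a with f a ∈? used
        ... | yes fa∈used = inj₂ fa∈used
        ... | no  _       = inj₁ (product12-one 4)
        truncated-used : ∀ a → f a ∈ used → truncated a ≡ f a
        truncated-used a fa∈used with f a ∈? used
        ... | yes _         = refl
        ... | no  fa∉used   = contradiction fa∈used fa∉used
        agree : ∀ {x y} → (x , y) ∈ entries r r′ c c′ c″ → weighted truncated x y ≡ weighted f x y
        agree {x} {y} xy∈entries = sumAll-local b (λ z z∈ →
          cong (_* ρ ((x ++ y) ++ z)) (truncated-used (position ((x ++ y) ++ z))
            (∈-concat⁺′ (∈-map⁺ (λ z → f (position ((x ++ y) ++ z))) z∈) (∈-map⁺ values-at xy∈entries))))

Unary : ∀ d → Lang d
Unary d k f = k ≡ 1

-- The core step: for a pps-formula over L ∪ Unary, the 2×2 condition is proved by moving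
-- its atoms one at a time into a formula over L ∪ B1-products 4; unary atoms are moved with
-- the interpolation argument, all others directly.
module Interpolation {d : ℕ} {L : Lang d} (balanced : Balanced (L ∪ B1-products d 4))
  {k m : ℕ} (0<k : 0 < k) (0<m : 0 < m) (b : ℕ)
  (r r′ : Fin k → Fin d) (c c′ c″ : Fin m → Fin d) where

  Assignment : Set
  Assignment = Fin (k ℕ.+ m ℕ.+ b) → Fin d

  Good : (Assignment → ℚ) → Set
  Good ω = MinorAt (matrix b ω) r r′ c c′ c″

  good-cong : ∀ {ω ω′} → (∀ w → ω w ≡ ω′ w) → Good ω → Good ω′
  good-cong ω≗ω′ = minorAt-cong (matrix-cong {k = k} {m} b ω≗ω′)

  good-base : (Bs : List (Atom (L ∪ B1-products d 4) (k ℕ.+ m ℕ.+ b))) → Good (weight Bs)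
  good-base Bs = blockRank1⇒localRank1 _
    (balanced k m 0<k 0<m _ (record { bound = b ; atoms = Bs } , λ _ → refl)) r r′ c c′ c″

  absorb : ∀ (Bs : List (Atom (L ∪ B1-products d 4) (k ℕ.+ m ℕ.+ b))) (As : List (Atom (L ∪ Unary d) (k ℕ.+ m ℕ.+ b)))
    (e : Assignment → ℚ) → Good (λ w → (e w * weight Bs w) * weight As w) →
    Good (λ w → weight Bs w * (e w * weight As w))
  absorb Bs As e = good-cong (λ w → rotate (e w) (weight Bs w) (weight As w))
    where
      rotate : ∀ e b a → (e * b) * a ≡ b * (e * a)
      rotate = solve-∀ ℚ-ring

  claim : (As : List (Atom (L ∪ Unary d) (k ℕ.+ m ℕ.+ b))) (Bs : List (Atom (L ∪ B1-products d 4) (k ℕ.+ m ℕ.+ b))) →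
    Good (λ w → weight Bs w * weight As w)
  claim [] Bs = good-cong (λ w → sym (*-identityʳ (weight Bs w))) (good-base Bs)
  claim (app k′ f (inj₁ f∈L) σ ∷ As) Bs =
    absorb Bs As (λ w → f (λ i → w (σ i))) (claim As (app k′ f (inj₁ f∈L) σ ∷ Bs))
  claim (eq i j ∷ As) Bs =
    absorb Bs As (evalAtom {L = L ∪ Unary d} (eq i j)) (claim As (eq i j ∷ Bs))
  claim (app .1 f (inj₂ refl) σ ∷ As) Bs =
    good-cong (λ w → rotate (f (position w)) (weight Bs w) (weight As w)) (U.good good-on-products f)
    where
      position : Assignment → (Fin 1 → Fin d)
      position w i = w (σ i)
      module U = UnaryInterpolation position (λ w → weight Bs w * weight As w) r r′ c c′ c″
      rotate : ∀ e b a → e * (b * a) ≡ b * (e * a)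
      rotate = solve-∀ ℚ-ring
      good-on-products : ∀ g → (∀ a → Product12 4 (g a)) → U.Good g
      good-on-products g g∈P = good-cong (λ w → *-assoc (g (position w)) (weight Bs w) (weight As w))
        (claim As (app 1 g (inj₂ (refl , g∈P)) σ ∷ Bs))

balanced-interpolate : ∀ {d} {L : Lang d} → Balanced (L ∪ B1-products d 4) → Balanced (L ∪ Unary d)
balanced-interpolate {d} balanced k m 0<k 0<m F (φ , φ≗F) =
  localRank1⇒blockRank1 _ (localRank1-cong (λ x y → φ≗F (x ++ y)) λ r r′ c c′ c″ →
    minorAt-cong (matrix-cong {k = k} {m} b (λ w → *-identityˡ (weight (atoms φ) w)))
      (Interpolation.claim balanced 0<k 0<m b r r′ c c′ c″ (atoms φ) []))
  where b = bound φ

∪-monoʳ : ∀ {d} {L M M′ : Lang d} → M ⊆L M′ → (L ∪ M) ⊆L (L ∪ M′)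
∪-monoʳ M⊆M′ k f (inj₁ f∈L) = inj₁ f∈L
∪-monoʳ M⊆M′ k f (inj₂ f∈M) = inj₂ (M⊆M′ k f f∈M)

B1'⊆B1 : ∀ {d} → B1' d ⊆L B1 d
B1'⊆B1 k f (k≡1 , f∈12) = k≡1 , λ x → nonNegative (f∈12 x)
  where
    nonNegative : ∀ {a} → One-or-two a → 0ℚ ≤ℚ a
    nonNegative (inj₁ refl) = nonNegative⁻¹ 1ℚ
    nonNegative (inj₂ refl) = nonNegative⁻¹ 2ℚ

B1⊆Unary : ∀ {d} → B1 d ⊆L Unary d
B1⊆Unary k f (k≡1 , _) = k≡1

factorise-over-B1' : ∀ {d} {L : Lang d} n k f → (L ∪ B1-products d n) k f → Factorises (L ∪ B1' d) k f
factorise-over-B1' n k f (inj₁ f∈L) = f ∷ [] , inj₁ f∈L ∷ [] , λ x → sym (*-identityʳ (f x))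
factorise-over-B1' n 1 f (inj₂ (refl , f∈P)) with factorise-products n f f∈P
... | gs , gs∈B1' , f≗gs = gs , All.map inj₂ gs∈B1' , f≗gs

balanced-B1'⇒B1 : ∀ {d} {L : Lang d} → Balanced (L ∪ B1' d) → Balanced (L ∪ B1 d)
balanced-B1'⇒B1 =
  balanced-antitone (∪-monoʳ B1⊆Unary) ∘ balanced-interpolate ∘ balanced-simulate (factorise-over-B1' 4)

lemma13 : (d : ℕ) → 2 ≤ d → (H : List (Σ ℕ (Fun d))) →
    All (λ p → NonNeg (Σ.proj₂ p)) H →
    (Balanced (listLang H ∪ B1' d) ⇔
      ((S : List (Σ ℕ (Fun d))) → listLang S ⊆L (listLang H ∪ B1 d) → Balanced (listLang S)))
    × (Balanced (listLang H ∪ B1' d) ⇔ Balanced (listLang H ∪ B1 d))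
lemma13 d _ H _ = mk⇔ (3⇒2 ∘ 1⇒3) (3⇒1 ∘ 2⇒3) , mk⇔ 1⇒3 3⇒1
  where
    1⇒3 : Balanced (listLang H ∪ B1' d) → Balanced (listLang H ∪ B1 d)
    1⇒3 = balanced-B1'⇒B1
    3⇒1 : Balanced (listLang H ∪ B1 d) → Balanced (listLang H ∪ B1' d)
    3⇒1 = balanced-antitone (∪-monoʳ B1'⊆B1)
    3⇒2 : Balanced (listLang H ∪ B1 d) →
      (S : List (Σ ℕ (Fun d))) → listLang S ⊆L (listLang H ∪ B1 d) → Balanced (listLang S)
    3⇒2 balanced S S⊆L = balanced-antitone S⊆L balanced
    2⇒3 : ((S : List (Σ ℕ (Fun d))) → listLang S ⊆L (listLang H ∪ B1 d) → Balanced (listLang S)) →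
      Balanced (listLang H ∪ B1 d)
    2⇒3 = balanced-from-finite
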